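{- In the edge-distinguishing game (EDGe) played on the cycle $C_4$ (with $\lambda(C_4)$ colors), Player 2 has a winning strategy.
   Context: $C_n$ is the cycle on $n$ vertices. For a positive integer $k$ let $[k]=\{1,\dots,k\}$. A $k$-coloring $c:V(G)\to[k]$ induces $c'(\{u,v\})=\{c(u),c(v)\}$ (a multiset); $c$ is edge-distinguishing if $c'$ is injective, and $\lambda(G)$ is the least $k$ admitting such a coloring. A partial coloring on $U\subseteq V(G)$ has partial induced edge coloring on $G[U]$. EDGe on $G$: two players, Player 1 first, alternately color an uncolored vertex with a color from $[\lambda(G)]$; a move is legal iff afterwards the partial induced edge coloring of the colored vertices is injective. The player making the last legal move wins. A winning strategy guarantees a win regardless of the opponent's play. -}

module Defs where

open import Data.Nat using (ℕ; suc; _<_; _%_; NonZero)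
open import Data.Fin using (Fin; toℕ; _≟_)
open import Data.Maybe using (Maybe; just; nothing)
open import Data.Product using (Σ; _×_; _,_)
open import Data.Sum using (_⊎_)
open import Relation.Nullary using (¬_; yes; no)
open import Relation.Binary.PropositionalEquality using (_≡_)

-- A (simple, undirected) graph on vertex set Fin n, given by a symmetric
-- adjacency relation.
record Graph : Set₁ where
  field
    n   : ℕ
    Adj : Fin n → Fin n → Set

open Graph public

-- The cycle C_m on vertices 0,…,m-1 (meaningful for m ≥ 3):
-- i ~ j iff j ≡ i+1 (mod m) or i ≡ j+1 (mod m).
C : (m : ℕ) → .{{NonZero m}} → Graph
C m = record
  { n   = m
  ; Adj = λ i j → (toℕ j ≡ suc (toℕ i) % m) ⊎ (toℕ i ≡ suc (toℕ j) % m)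
  }

SamePair : {A : Set} → A → A → A → A → Set
SamePair a b a' b' = (a ≡ a' × b ≡ b') ⊎ (a ≡ b' × b ≡ a')

PartialColoring : Graph → ℕ → Set
PartialColoring G k = Fin (n G) → Maybe (Fin k)

PartialEdgeDist : (G : Graph) (k : ℕ) → PartialColoring G k → Set
PartialEdgeDist G k c =
  ∀ u v x y a b a' b' → Adj G u v → Adj G x y →
  c u ≡ just a → c v ≡ just b → c x ≡ just a' → c y ≡ just b' →
  SamePair a b a' b' → SamePair u v x y

EdgeDistinguishing : (G : Graph) (k : ℕ) → (Fin (n G) → Fin k) → Set
EdgeDistinguishing G k c = PartialEdgeDist G k (λ v → just (c v))

IsLambda : Graph → ℕ → Set
IsLambda G k =
  (Σ (Fin (n G) → Fin k) λ c → EdgeDistinguishing G k c) ×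
  (∀ j → j < k → ¬ (Σ (Fin (n G) → Fin j) λ c → EdgeDistinguishing G j c))

update : {G : Graph} {k : ℕ} → PartialColoring G k → Fin (n G) → Fin k → PartialColoring G k
update c v a w with w ≟ v
... | yes _ = just a
... | no  _ = c w

-- The EDGe game with k colors: a legal move colors an uncolored vertex so that
-- the partial induced edge coloring stays injective; the last player to move wins.
-- Since the game is finite, "the player to move has a winning strategy" (ToMoveWins)
-- and "the player to move loses against any play of the opponent" (ToMoveLoses)
-- are defined by mutual induction over the game tree.
mutual
  data ToMoveWins (G : Graph) (k : ℕ) (c : PartialColoring G k) : Set where
    win : (v : Fin (n G)) (a : Fin k) → c v ≡ nothing →
          PartialEdgeDist G k (update {G} c v a) →
          ToMoveLoses G k (update {G} c v a) → ToMoveWins G k c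

  data ToMoveLoses (G : Graph) (k : ℕ) (c : PartialColoring G k) : Set where
    lose : ((v : Fin (n G)) (a : Fin k) → c v ≡ nothing →
            PartialEdgeDist G k (update {G} c v a) →
            ToMoveWins G k (update {G} c v a)) → ToMoveLoses G k c

empty : (G : Graph) (k : ℕ) → PartialColoring G k
empty G k _ = nothing

Player2Wins : Graph → ℕ → Set
Player2Wins G k = ToMoveLoses G k (empty G k)

{-# OPTIONS --safe #-}
module Submission where

-- C₄ is K₂,₂, the complement of the perfect matching v ↦ v + 2. Player 2 answers
-- Player 1's first move (v, a) by colouring the antipode of v with the same colour a.
-- Each of the two remaining vertices is then adjacent to two distinct vertices of
-- colour a, so whatever colour x it gets, its two edges both receive {a, x}: no legal
-- move is left and Player 1 loses. This works for any number of colours.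

open import Defs
open import Data.Nat as ℕ using (ℕ; suc; _%_; NonZero)
open import Data.Fin using (Fin; toℕ; _≟_)
open import Data.Fin.Patterns using (0F; 1F; 2F; 3F)
open import Data.Fin.Properties using (all?)
open import Data.Maybe using (just; nothing)
open import Data.Product using (_×_; _,_)
open import Data.Sum using (_⊎_; inj₁; inj₂)
open import Data.Empty using (⊥; ⊥-elim)
open import Function using (_∘_; case_of_)
open import Function.Bundles using (_⇔_; mk⇔; Equivalence)
open import Relation.Nullary using (¬_; Dec; yes; no; ¬?; contradiction)
open import Relation.Nullary.Decidable using (_×-dec_; _⊎-dec_; _→-dec_; from-yes)
open import Relation.Binary.Definitions using (Decidable)
open import Relation.Binary.PropositionalEquality using (_≡_; _≢_; refl; sym; trans; subst)

module _ {G : Graph} {k : ℕ} where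

  update-≡ : (c : PartialColoring G k) (v : Fin (n G)) (a : Fin k) →
             update {G} c v a v ≡ just a
  update-≡ c v a with v ≟ v
  ... | yes _  = refl
  ... | no v≢v = contradiction refl v≢v

  update-≢ : (c : PartialColoring G k) {v w : Fin (n G)} (a : Fin k) →
             w ≢ v → update {G} c v a w ≡ c w
  update-≢ c {v} {w} a w≢v with w ≟ v
  ... | yes w≡v = contradiction w≡v w≢v
  ... | no _    = refl

  update-just : (c : PartialColoring G k) {v w : Fin (n G)} {a b : Fin k} →
                update {G} c v a w ≡ just b → w ≡ v ⊎ c w ≡ just b
  update-just c {v} {w} cw with w ≟ v
  ... | yes w≡v = inj₁ w≡v
  ... | no _    = inj₂ cw

  coloured≢uncoloured : (c : PartialColoring G k) {u w : Fin (n G)} {a : Fin k} →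
                        c u ≡ just a → c w ≡ nothing → u ≢ w
  coloured≢uncoloured c cu cw refl = case trans (sym cu) cw of λ ()

  noColouredEdge⇒edgeDist : (c : PartialColoring G k) →
    (∀ {u w a b} → Adj G u w → c u ≡ just a → c w ≡ just b → ⊥) →
    PartialEdgeDist G k c
  noColouredEdge⇒edgeDist c noEdge u v _ _ _ _ _ _ uv _ cu cv _ _ _ =
    ⊥-elim (noEdge uv cu cv)

  twinNeighbours⇒illegal : (c : PartialColoring G k) {u u′ w : Fin (n G)} {a : Fin k} →
    u ≢ u′ → Adj G w u → Adj G w u′ → c u ≡ just a → c u′ ≡ just a → c w ≡ nothing →
    (b : Fin k) → ¬ PartialEdgeDist G k (update {G} c w b)
  twinNeighbours⇒illegal c {u} {u′} {w} u≢u′ wu wu′ cu cu′ cw b legal =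
    twins≢ (legal w u w u′ b _ b _ wu wu′ (update-≡ c w b) (recoloured cu)
                  (update-≡ c w b) (recoloured cu′) (inj₁ (refl , refl)))
    where
      recoloured : ∀ {x a} → c x ≡ just a → update {G} c w b x ≡ just a
      recoloured cx = trans (update-≢ c b (coloured≢uncoloured c cx cw)) cx
      twins≢ : ¬ SamePair w u w u′
      twins≢ (inj₁ (_ , u≡u′))     = u≢u′ u≡u′
      twins≢ (inj₂ (w≡u′ , u≡w)) = u≢u′ (trans u≡w w≡u′)

  stuck⇒loses : (c : PartialColoring G k) →
    (∀ w b → c w ≡ nothing → ¬ PartialEdgeDist G k (update {G} c w b)) →
    ToMoveLoses G k c
  stuck⇒loses c stuck = lose λ w b free legal → ⊥-elim (stuck w b free legal)

module Mirroring
  (G : Graph) (σ : Fin (n G) → Fin (n G))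
  (σ-involutive : ∀ v → σ (σ v) ≡ v)
  (σ-fixpointFree : ∀ v → σ v ≢ v)
  (adjacent⇔ : ∀ u w → Adj G u w ⇔ (u ≢ w × u ≢ σ w))
  where

  open Equivalence

  pair-independent : ∀ {v u w} → u ≡ v ⊎ u ≡ σ v → w ≡ v ⊎ w ≡ σ v → ¬ Adj G u w
  pair-independent {v} u∈ w∈ uw with to (adjacent⇔ _ _) uw | u∈ | w∈
  ... | u≢w , _    | inj₁ refl | inj₁ refl = u≢w refl
  ... | _ , u≢σw   | inj₁ refl | inj₂ refl = u≢σw (sym (σ-involutive v))
  ... | _ , u≢σw   | inj₂ refl | inj₁ refl = u≢σw refl
  ... | u≢w , _    | inj₂ refl | inj₂ refl = u≢w refl

  module _ {k : ℕ} (v : Fin (n G)) (a : Fin k) where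

    afterFirstMove : PartialColoring G k
    afterFirstMove = update {G} (empty G k) v a

    mirrored : PartialColoring G k
    mirrored = update {G} afterFirstMove (σ v) a

    mirrored-v : mirrored v ≡ just a
    mirrored-v = trans (update-≢ afterFirstMove a (σ-fixpointFree v ∘ sym)) (update-≡ (empty G k) v a)

    mirrored-σv : mirrored (σ v) ≡ just a
    mirrored-σv = update-≡ afterFirstMove (σ v) a

    mirrored-coloured : ∀ {u b} → mirrored u ≡ just b → u ≡ v ⊎ u ≡ σ v
    mirrored-coloured mu with update-just afterFirstMove mu
    ... | inj₁ u≡σv = inj₂ u≡σv
    ... | inj₂ mu′ with update-just (empty G k) mu′
    ...   | inj₁ u≡v = inj₁ u≡v
    ...   | inj₂ ()

    mirrored-legal : PartialEdgeDist G k mirrored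
    mirrored-legal = noColouredEdge⇒edgeDist mirrored λ uw mu mw →
      pair-independent (mirrored-coloured mu) (mirrored-coloured mw) uw

    mirrored-stuck : ∀ w b → mirrored w ≡ nothing → ¬ PartialEdgeDist G k (update {G} mirrored w b)
    mirrored-stuck w b free =
      twinNeighbours⇒illegal mirrored (σ-fixpointFree v ∘ sym) wv wσv mirrored-v mirrored-σv free b
      where
        w≢v : w ≢ v
        w≢v w≡v = coloured≢uncoloured {G} mirrored mirrored-v free (sym w≡v)
        w≢σv : w ≢ σ v
        w≢σv w≡σv = coloured≢uncoloured {G} mirrored mirrored-σv free (sym w≡σv)
        wv : Adj G w v
        wv = from (adjacent⇔ w v) (w≢v , w≢σv)
        wσv : Adj G w (σ v)
        wσv = from (adjacent⇔ w (σ v)) (w≢σv , subst (w ≢_) (sym (σ-involutive v)) w≢v)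

  player2Wins : ∀ k → Player2Wins G k
  player2Wins k = lose λ v a _ _ →
    win (σ v) a (update-≢ (empty G k) a (σ-fixpointFree v))
        (mirrored-legal v a) (stuck⇒loses _ (mirrored-stuck v a))

C-adjacent? : (m : ℕ) .{{_ : NonZero m}} → Decidable (Adj (C m))
C-adjacent? m i j = (toℕ j ℕ.≟ suc (toℕ i) % m) ⊎-dec (toℕ i ℕ.≟ suc (toℕ j) % m)

opposite : Fin 4 → Fin 4
opposite 0F = 2F
opposite 1F = 3F
opposite 2F = 0F
opposite 3F = 1F

opposite-involutive : ∀ v → opposite (opposite v) ≡ v
opposite-involutive 0F = refl
opposite-involutive 1F = refl
opposite-involutive 2F = refl
opposite-involutive 3F = refl

opposite-≢ : ∀ v → opposite v ≢ v
opposite-≢ 0F ()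
opposite-≢ 1F ()
opposite-≢ 2F ()
opposite-≢ 3F ()

C₄-adjacent⇔ : ∀ u w → Adj (C 4) u w ⇔ (u ≢ w × u ≢ opposite w)
C₄-adjacent⇔ u w = mk⇔ (adjacent⇒ u w) (⇒adjacent u w)
  where
    apart? : (u w : Fin 4) → Dec (u ≢ w × u ≢ opposite w)
    apart? u w = ¬? (u ≟ w) ×-dec ¬? (u ≟ opposite w)
    adjacent⇒ : ∀ u w → Adj (C 4) u w → u ≢ w × u ≢ opposite w
    adjacent⇒ = from-yes (all? λ u → all? λ w → C-adjacent? 4 u w →-dec apart? u w)
    ⇒adjacent : ∀ u w → u ≢ w × u ≢ opposite w → Adj (C 4) u w
    ⇒adjacent = from-yes (all? λ u → all? λ w → apart? u w →-dec C-adjacent? 4 u w)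

theorem3p13 : (k : ℕ) → IsLambda (C 4) k → Player2Wins (C 4) k
theorem3p13 k _ =
  Mirroring.player2Wins (C 4) opposite opposite-involutive opposite-≢ C₄-adjacent⇔ k
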